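{- Let $n\geq 0$ and $m\geq 1$ be integers. Then $$\sum_{i=0}^{n}(-1)^i s_{(i)}(\mathbf{x})\, s_{(m+1,1^{n-i})}(\mathbf{x})=(-1)^n s_{(m+n+1)}(\mathbf{x}).$$
   Context: $s_\lambda(\mathbf{x})$ denotes the Schur function indexed by the partition $\lambda$ in infinitely many variables $\mathbf{x}=(x_1,x_2,\ldots)$; $s_{(i)}=h_i$ is the complete homogeneous symmetric function, with $s_{(0)}=1$. In partition notation, $1^k$ denotes $k$ parts equal to $1$. -}

module Defs where

open import Data.Bool using (Bool; true; false; _∧_; if_then_else_)
open import Data.Nat using (ℕ; zero; suc; _+_; _∸_; _<ᵇ_; _≡ᵇ_)
open import Data.Integer as ℤ using (ℤ)
open import Data.List using (List; []; _∷_; map; concatMap; upTo; replicate)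
open import Data.Vec as V using (Vec; []; _∷_)
open import Data.Product using (_×_; _,_)

-- A (formal power series) coefficient functional in the variables x_1, x_2, ...
-- For each k and each exponent vector α ∈ ℕ^k it gives the coefficient of the
-- monomial x_1^{α_1} ... x_k^{α_k} (all further variables with exponent 0).
-- Two series are equal iff these coefficients agree for all k and α.
Coeff : Set
Coeff = (k : ℕ) → Vec ℕ k → ℤ

Shape : Set
Shape = List ℕ

-- A tableau: a list of rows, each row a list of entries.
-- Entries j ∈ {0,...,k-1} stand for the variable x_{j+1}.
Tableau : Set
Tableau = List (List ℕ)

incRows : ℕ → ℕ → ℕ → List (List ℕ)
incRows k lo zero    = [] ∷ []
incRows k lo (suc r) =
  concatMap (λ a → map (a ∷_) (incRows k a r)) (map (lo +_) (upTo (k ∸ lo)))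

rowFillings : ℕ → Shape → List Tableau
rowFillings k []      = [] ∷ []
rowFillings k (r ∷ λ′) =
  concatMap (λ row → map (row ∷_) (rowFillings k λ′)) (incRows k 0 r)

strictBelow : List ℕ → List ℕ → Bool
strictBelow _        []       = true
strictBelow []       (_ ∷ _)  = false
strictBelow (a ∷ as) (b ∷ bs) = (a <ᵇ b) ∧ strictBelow as bs

columnStrict : Tableau → Bool
columnStrict (r₁ ∷ r₂ ∷ rs) = strictBelow r₁ r₂ ∧ columnStrict (r₂ ∷ rs)
columnStrict _              = true

countIn : ℕ → List ℕ → ℕ
countIn j []       = 0
countIn j (a ∷ as) = (if j ≡ᵇ a then 1 else 0) + countIn j as

countInT : ℕ → Tableau → ℕ
countInT j []       = 0
countInT j (r ∷ rs) = countIn j r + countInT j rs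

hasContentFrom : ℕ → {k : ℕ} → Vec ℕ k → Tableau → Bool
hasContentFrom j []       T = true
hasContentFrom j (a ∷ α)  T = (countInT j T ≡ᵇ a) ∧ hasContentFrom (suc j) α T

countTrue : {A : Set} → (A → Bool) → List A → ℕ
countTrue p []       = 0
countTrue p (x ∷ xs) = (if p x then 1 else 0) + countTrue p xs

schur : Shape → Coeff
schur λ′ k α = ℤ.+ countTrue (λ T → columnStrict T ∧ hasContentFrom 0 α T)
                              (rowFillings k λ′)

h : ℕ → Coeff
h i = schur (i ∷ [])

splits : {k : ℕ} → Vec ℕ k → List (Vec ℕ k × Vec ℕ k)
splits []      = ([] , []) ∷ []
splits (a ∷ α) =
  concatMap (λ j → map (λ { (β , γ) → (j ∷ β , (a ∸ j) ∷ γ) }) (splits α))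
            (upTo (suc a))

sumℤ : List ℤ → ℤ
sumℤ []       = ℤ.0ℤ
sumℤ (x ∷ xs) = x ℤ.+ sumℤ xs

_⊙_ : Coeff → Coeff → Coeff
(f ⊙ g) k α = sumℤ (map (λ { (β , γ) → f k β ℤ.* g k γ }) (splits α))

sign : ℕ → ℤ
sign zero    = ℤ.1ℤ
sign (suc i) = ℤ.- sign i

hook : ℕ → ℕ → Shape
hook m j = suc m ∷ replicate j 1

-- All coefficients are computed in closed form. Writing |α| for the size of α and p(α) for its number of
-- nonzero entries, the coefficient of x^α in h_r is [|α| = r], and in s_(m+1,1^j) it is
-- [|α| = m+1+j] · C(p(α) - 1, j): the corner of a hook tableau is its smallest letter, the rest of the
-- first column is any j of the other letters occurring in α, and the first row is then forced.
-- Collapsing the sum over i, the coefficient of x^α on the left becomes [|α| = m+n+1] times the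
-- coefficient of t^n in ∑_{β+γ=α} (-t)^|β| (1+t)^(p(γ)-1). The same sum with exponent p(γ) equals 1,
-- as it factors over the coordinates of α and each factor telescopes; Pascal's rule then shows that the
-- coefficient of t^n in the former is (-1)^n whenever n < |α|.
module Submission where

open import Defs
open import Data.Bool using (Bool; true; false; _∧_; if_then_else_)
open import Data.Bool.Properties using (∧-assoc; ∧-identityʳ)
open import Data.Empty using (⊥-elim)
open import Data.Integer as ℤ using (ℤ; 0ℤ; 1ℤ)
  renaming (_*_ to _*ℤ_; _+_ to _+ℤ_; _-_ to _-ℤ_; -_ to -ℤ_)
import Data.Integer.Properties as ℤₚ
open import Data.Integer.Tactic.RingSolver using (solve-∀)
import Data.Nat.Tactic.RingSolver as ℕ-Solver
open import Data.List using (List; []; _∷_; _∷ʳ_; _++_; map; concatMap; upTo; applyUpTo; replicate; [_])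
open import Data.List.Properties using (map-∘; map-cong; map-cong-local; map-applyUpTo; map-upTo; upTo-∷ʳ)
open import Data.List.Relation.Unary.All as All using (All; []; _∷_)
open import Data.List.Relation.Unary.All.Properties using (map⁺; concat⁺; applyUpTo⁺₁; applyUpTo⁺₂)
open import Data.Nat
  using (ℕ; zero; suc; pred; _+_; _∸_; _≡ᵇ_; _<ᵇ_; _≤_; _<_; _≤?_; _<?_; _≟_; z≤n; s≤s; s≤s⁻¹; z<s)
open import Data.Nat.Combinatorics using (_C_; k>n⇒nCk≡0; nCk+nC[k+1]≡[n+1]C[k+1])
open import Data.Nat.Properties
open import Data.Product using (_×_; _,_; proj₁; proj₂)
open import Data.Vec as Vec using (Vec; []; _∷_)
open import Function using (_∘_)
open import Relation.Binary.PropositionalEquality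
  using (_≡_; refl; sym; trans; cong; cong₂; subst; subst₂; module ≡-Reasoning)
open import Relation.Nullary using (Dec; yes; no; does; ¬_)
open import Relation.Nullary.Decidable using (dec-true; dec-false)

private variable
  A B : Set
  L : ℕ

-- Indicators and finite sums

⟦_⟧ : Bool → ℤ
⟦ b ⟧ = if b then 1ℤ else 0ℤ

𝟙 : {P : Set} → Dec P → ℤ
𝟙 d = ⟦ does d ⟧

𝟙-yes : {P : Set} (d : Dec P) → P → 𝟙 d ≡ 1ℤ
𝟙-yes d p = cong ⟦_⟧ (dec-true d p)

𝟙-no : {P : Set} (d : Dec P) → ¬ P → 𝟙 d ≡ 0ℤ
𝟙-no d ¬p = cong ⟦_⟧ (dec-false d ¬p)

𝟙-cong : {P Q : Set} → (P → Q) → (Q → P) → (p? : Dec P) (q? : Dec Q) → 𝟙 p? ≡ 𝟙 q?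
𝟙-cong f g (yes p) q? = sym (𝟙-yes q? (f p))
𝟙-cong f g (no ¬p) q? = sym (𝟙-no q? (¬p ∘ g))

𝟙-s≤s : ∀ m n → 𝟙 (suc m ≤? suc n) ≡ 𝟙 (m ≤? n)
𝟙-s≤s zero    n = refl
𝟙-s≤s (suc m) n = refl

⟦∧⟧ : ∀ b c → ⟦ b ∧ c ⟧ ≡ ⟦ b ⟧ *ℤ ⟦ c ⟧
⟦∧⟧ true  c = sym (ℤₚ.*-identityˡ ⟦ c ⟧)
⟦∧⟧ false c = refl

∑ : List A → (A → ℤ) → ℤ
∑ xs f = sumℤ (map f xs)

∑-++ : ∀ (xs ys : List A) f → ∑ (xs ++ ys) f ≡ ∑ xs f +ℤ ∑ ys f
∑-++ []       ys f = sym (ℤₚ.+-identityˡ _)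
∑-++ (x ∷ xs) ys f = trans (cong (f x +ℤ_) (∑-++ xs ys f)) (sym (ℤₚ.+-assoc (f x) _ _))

∑-map : ∀ (g : A → B) xs f → ∑ (map g xs) f ≡ ∑ xs (f ∘ g)
∑-map g xs f = cong sumℤ (sym (map-∘ xs))

∑-concatMap : ∀ (g : A → List B) xs f → ∑ (concatMap g xs) f ≡ ∑ xs (λ x → ∑ (g x) f)
∑-concatMap g []       f = refl
∑-concatMap g (x ∷ xs) f =
  trans (∑-++ (g x) (concatMap g xs) f) (cong (∑ (g x) f +ℤ_) (∑-concatMap g xs f))

∑-cong : ∀ xs {f g : A → ℤ} → (∀ x → f x ≡ g x) → ∑ xs f ≡ ∑ xs g
∑-cong xs f≗g = cong sumℤ (map-cong f≗g xs)

∑-congᴬ : ∀ {xs} {f g : A → ℤ} → All (λ x → f x ≡ g x) xs → ∑ xs f ≡ ∑ xs g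
∑-congᴬ eqs = cong sumℤ (map-cong-local eqs)

∑-zero : ∀ (xs : List A) → ∑ xs (λ _ → 0ℤ) ≡ 0ℤ
∑-zero []       = refl
∑-zero (x ∷ xs) = trans (ℤₚ.+-identityˡ _) (∑-zero xs)

∑-*ˡ : ∀ c (xs : List A) f → ∑ xs (λ x → c *ℤ f x) ≡ c *ℤ ∑ xs f
∑-*ˡ c []       f = sym (ℤₚ.*-zeroʳ c)
∑-*ˡ c (x ∷ xs) f =
  trans (cong (c *ℤ f x +ℤ_) (∑-*ˡ c xs f)) (sym (ℤₚ.*-distribˡ-+ c (f x) _))

∑-+ : ∀ (xs : List A) f g → ∑ xs (λ x → f x +ℤ g x) ≡ ∑ xs f +ℤ ∑ xs g
∑-+ []       f g = refl
∑-+ (x ∷ xs) f g = trans (cong (f x +ℤ g x +ℤ_) (∑-+ xs f g)) (interchange (f x) (g x) _ _)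
  where
  interchange : ∀ a b c d → a +ℤ b +ℤ (c +ℤ d) ≡ a +ℤ c +ℤ (b +ℤ d)
  interchange = solve-∀

∑-neg : ∀ (xs : List A) f → ∑ xs (λ x → -ℤ f x) ≡ -ℤ ∑ xs f
∑-neg []       f = refl
∑-neg (x ∷ xs) f = trans (cong (-ℤ f x +ℤ_) (∑-neg xs f)) (sym (ℤₚ.neg-distrib-+ (f x) _))

∑-swap : ∀ (xs : List A) (ys : List B) (f : A → B → ℤ) →
  ∑ xs (λ x → ∑ ys (f x)) ≡ ∑ ys (λ y → ∑ xs (λ x → f x y))
∑-swap []       ys f = sym (∑-zero ys)
∑-swap (x ∷ xs) ys f = trans (cong (∑ ys (f x) +ℤ_) (∑-swap xs ys f))
                             (sym (∑-+ ys (f x) (λ y → ∑ xs (λ x′ → f x′ y))))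

countTrue-∑ : ∀ (p : A → Bool) xs → ℤ.+ countTrue p xs ≡ ∑ xs (λ x → ⟦ p x ⟧)
countTrue-∑ p []       = refl
countTrue-∑ p (x ∷ xs) = trans (ℤₚ.pos-+ (if p x then 1 else 0) (countTrue p xs))
                               (cong₂ _+ℤ_ (indicator (p x)) (countTrue-∑ p xs))
  where
  indicator : ∀ b → ℤ.+ (if b then 1 else 0) ≡ ⟦ b ⟧
  indicator true  = refl
  indicator false = refl

∑-upTo-suc : ∀ n (f : ℕ → ℤ) → ∑ (upTo (suc n)) f ≡ f 0 +ℤ ∑ (upTo n) (f ∘ suc)
∑-upTo-suc n f = cong (f 0 +ℤ_)
  (trans (cong sumℤ (map-applyUpTo suc f n)) (sym (cong sumℤ (map-applyUpTo (λ i → i) (f ∘ suc) n))))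

∑-upTo-∷ʳ : ∀ n (f : ℕ → ℤ) → ∑ (upTo (suc n)) f ≡ ∑ (upTo n) f +ℤ f n
∑-upTo-∷ʳ n f = begin
  ∑ (upTo (suc n)) f           ≡⟨ cong (λ xs → ∑ xs f) (upTo-∷ʳ n) ⟨
  ∑ (upTo n ∷ʳ n) f            ≡⟨ ∑-++ (upTo n) [ n ] f ⟩
  ∑ (upTo n) f +ℤ (f n +ℤ 0ℤ)  ≡⟨ cong (∑ (upTo n) f +ℤ_) (ℤₚ.+-identityʳ (f n)) ⟩
  ∑ (upTo n) f +ℤ f n          ∎
  where open ≡-Reasoning

∑-telescope : ∀ n (g : ℕ → ℤ) → ∑ (upTo n) (λ b → g b -ℤ g (suc b)) +ℤ g n ≡ g 0
∑-telescope zero    g = ℤₚ.+-identityˡ (g 0)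
∑-telescope (suc n) g = begin
  ∑ (upTo (suc n)) G +ℤ g (suc n)                  ≡⟨ cong (_+ℤ g (suc n)) (∑-upTo-∷ʳ n G) ⟩
  ∑ (upTo n) G +ℤ (g n -ℤ g (suc n)) +ℤ g (suc n)  ≡⟨ cancel (∑ (upTo n) G) (g n) (g (suc n)) ⟩
  ∑ (upTo n) G +ℤ g n                              ≡⟨ ∑-telescope n g ⟩
  g 0                                              ∎
  where
  open ≡-Reasoning
  G = λ b → g b -ℤ g (suc b)
  cancel : ∀ a b c → a +ℤ (b -ℤ c) +ℤ c ≡ a +ℤ b
  cancel = solve-∀

∑-upTo-δ : ∀ n c (f : ℕ → ℤ) →
  ∑ (upTo (suc n)) (λ i → 𝟙 (c ≟ i) *ℤ f i) ≡ 𝟙 (c ≤? n) *ℤ f c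
∑-upTo-δ zero    zero    f = ℤₚ.+-identityʳ _
∑-upTo-δ zero    (suc c) f = refl
∑-upTo-δ (suc n) zero    f = begin
  ∑ (upTo (suc (suc n))) (λ i → 𝟙 (0 ≟ i) *ℤ f i)
    ≡⟨ ∑-upTo-suc (suc n) (λ i → 𝟙 (0 ≟ i) *ℤ f i) ⟩
  1ℤ *ℤ f 0 +ℤ ∑ (upTo (suc n)) (λ _ → 0ℤ)
    ≡⟨ cong (1ℤ *ℤ f 0 +ℤ_) (∑-zero (upTo (suc n))) ⟩
  1ℤ *ℤ f 0 +ℤ 0ℤ
    ≡⟨ ℤₚ.+-identityʳ _ ⟩
  1ℤ *ℤ f 0 ∎
  where open ≡-Reasoning
∑-upTo-δ (suc n) (suc c) f = begin
  ∑ (upTo (suc (suc n))) (λ i → 𝟙 (suc c ≟ i) *ℤ f i)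
    ≡⟨ ∑-upTo-suc (suc n) (λ i → 𝟙 (suc c ≟ i) *ℤ f i) ⟩
  0ℤ +ℤ ∑ (upTo (suc n)) (λ i → 𝟙 (c ≟ i) *ℤ f (suc i))
    ≡⟨ ℤₚ.+-identityˡ _ ⟩
  ∑ (upTo (suc n)) (λ i → 𝟙 (c ≟ i) *ℤ f (suc i))
    ≡⟨ ∑-upTo-δ n c (f ∘ suc) ⟩
  𝟙 (c ≤? n) *ℤ f (suc c)
    ≡⟨ cong (_*ℤ f (suc c)) (𝟙-s≤s c n) ⟨
  𝟙 (suc c ≤? suc n) *ℤ f (suc c) ∎
  where open ≡-Reasoning

sign-+ : ∀ a b → sign (a + b) ≡ sign a *ℤ sign b
sign-+ zero    b = sym (ℤₚ.*-identityˡ (sign b))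
sign-+ (suc a) b = trans (cong -ℤ_ (sign-+ a b)) (ℤₚ.neg-distribˡ-* (sign a) (sign b))

∑-sign-δ : ∀ n (xs : List A) (b : A → ℕ) (f : ℕ → A → ℤ) →
  ∑ (upTo (suc n)) (λ i → sign i *ℤ ∑ xs (λ x → 𝟙 (b x ≟ i) *ℤ f i x))
    ≡ ∑ xs (λ x → 𝟙 (b x ≤? n) *ℤ (sign (b x) *ℤ f (b x) x))
∑-sign-δ n xs b f = begin
  ∑ (upTo (suc n)) (λ i → sign i *ℤ ∑ xs (λ x → 𝟙 (b x ≟ i) *ℤ f i x))
    ≡⟨ ∑-cong (upTo (suc n)) (λ i → sym (∑-*ˡ (sign i) xs _)) ⟩
  ∑ (upTo (suc n)) (λ i → ∑ xs (λ x → sign i *ℤ (𝟙 (b x ≟ i) *ℤ f i x)))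
    ≡⟨ ∑-swap (upTo (suc n)) xs _ ⟩
  ∑ xs (λ x → ∑ (upTo (suc n)) (λ i → sign i *ℤ (𝟙 (b x ≟ i) *ℤ f i x)))
    ≡⟨ ∑-cong xs (λ x → ∑-cong (upTo (suc n)) (λ i → swap (sign i) (𝟙 (b x ≟ i)) (f i x))) ⟩
  ∑ xs (λ x → ∑ (upTo (suc n)) (λ i → 𝟙 (b x ≟ i) *ℤ (sign i *ℤ f i x)))
    ≡⟨ ∑-cong xs (λ x → ∑-upTo-δ n (b x) (λ i → sign i *ℤ f i x)) ⟩
  ∑ xs (λ x → 𝟙 (b x ≤? n) *ℤ (sign (b x) *ℤ f (b x) x)) ∎
  where
  open ≡-Reasoning
  swap : ∀ σ e y → σ *ℤ (e *ℤ y) ≡ e *ℤ (σ *ℤ y)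
  swap = solve-∀

-- Power series in one variable

-- A power series in t is given by its coefficient sequence; [-t]^ b · f is (-t)^b f(t).
Series : Set
Series = ℕ → ℤ

one : Series
one s = 𝟙 (s ≟ 0)

infix  9 [1+t]^_
infixr 8 [-t]^_·_

[1+t]^_ : ℕ → Series
([1+t]^ p) s = ℤ.+ (p C s)

[-t]^_·_ : ℕ → Series → Series
([-t]^ b · f) s = 𝟙 (b ≤? s) *ℤ (sign b *ℤ f (s ∸ b))

[-t]^0· : ∀ f s → ([-t]^ 0 · f) s ≡ f s
[-t]^0· f s = trans (ℤₚ.*-identityˡ _) (ℤₚ.*-identityˡ (f s))

[-t]^·-vanish : ∀ {b s} f → s < b → ([-t]^ b · f) s ≡ 0ℤ
[-t]^·-vanish {b} {s} f s<b = cong (_*ℤ (sign b *ℤ f (s ∸ b))) (𝟙-no (b ≤? s) (<⇒≱ s<b))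

[-t]^·-cong : ∀ b {f g : Series} → (∀ t → f t ≡ g t) → ∀ s →
  ([-t]^ b · f) s ≡ ([-t]^ b · g) s
[-t]^·-cong b f≗g s = cong (λ v → 𝟙 (b ≤? s) *ℤ (sign b *ℤ v)) (f≗g (s ∸ b))

[-t]^·-+ : ∀ b f g s → ([-t]^ b · (λ t → f t +ℤ g t)) s ≡ ([-t]^ b · f) s +ℤ ([-t]^ b · g) s
[-t]^·-+ b f g s = distrib (𝟙 (b ≤? s)) (sign b) (f (s ∸ b)) (g (s ∸ b))
  where
  distrib : ∀ e σ x y → e *ℤ (σ *ℤ (x +ℤ y)) ≡ e *ℤ (σ *ℤ x) +ℤ e *ℤ (σ *ℤ y)
  distrib = solve-∀

[-t]^·-neg : ∀ b f s → ([-t]^ b · (λ t → -ℤ f t)) s ≡ -ℤ ([-t]^ b · f) s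
[-t]^·-neg b f s = negate (𝟙 (b ≤? s)) (sign b) (f (s ∸ b))
  where
  negate : ∀ e σ x → e *ℤ (σ *ℤ (-ℤ x)) ≡ -ℤ (e *ℤ (σ *ℤ x))
  negate = solve-∀

-- The decisions are taken as arguments: `with b ≤? s` would not abstract the 𝟙 (b ≤? s) inside [-t]^_·_.
[-t]^·-[-t]^· : ∀ b c f s → ([-t]^ b · [-t]^ c · f) s ≡ ([-t]^ (b + c) · f) s
[-t]^·-[-t]^· b c f s = compose (b ≤? s) (c ≤? s ∸ b) (b + c ≤? s)
  where
  compose : (b? : Dec (b ≤ s)) (c? : Dec (c ≤ s ∸ b)) (bc? : Dec (b + c ≤ s)) →
    𝟙 b? *ℤ (sign b *ℤ (𝟙 c? *ℤ (sign c *ℤ f (s ∸ b ∸ c))))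
      ≡ 𝟙 bc? *ℤ (sign (b + c) *ℤ f (s ∸ (b + c)))
  compose (yes _) (yes _) (yes _) rewrite sign-+ b c | ∸-+-assoc s b c = reassoc (sign b) (sign c) _
    where
    reassoc : ∀ x y z → 1ℤ *ℤ (x *ℤ (1ℤ *ℤ (y *ℤ z))) ≡ 1ℤ *ℤ (x *ℤ y *ℤ z)
    reassoc = solve-∀
  compose (yes b≤s) (yes c≤s∸b) (no b+c≰s) =
    ⊥-elim (b+c≰s (subst (b + c ≤_) (m+[n∸m]≡n b≤s) (+-monoʳ-≤ b c≤s∸b)))
  compose (yes _) (no c≰s∸b) (yes b+c≤s) =
    ⊥-elim (c≰s∸b (m+n≤o⇒m≤o∸n c (subst (_≤ s) (+-comm b c) b+c≤s)))
  compose (yes _) (no _) (no _) = trans (ℤₚ.*-identityˡ _) (ℤₚ.*-zeroʳ (sign b))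
  compose (no b≰s) c? (yes b+c≤s) = ⊥-elim (b≰s (m+n≤o⇒m≤o b b+c≤s))
  compose (no _) c? (no _) = refl

[-t]^·-comm : ∀ b c f s → ([-t]^ b · [-t]^ c · f) s ≡ ([-t]^ c · [-t]^ b · f) s
[-t]^·-comm b c f s = begin
  ([-t]^ b · [-t]^ c · f) s  ≡⟨ [-t]^·-[-t]^· b c f s ⟩
  ([-t]^ (b + c) · f) s      ≡⟨ cong (λ e → ([-t]^ e · f) s) (+-comm b c) ⟩
  ([-t]^ (c + b) · f) s      ≡⟨ [-t]^·-[-t]^· c b f s ⟨
  ([-t]^ c · [-t]^ b · f) s  ∎
  where open ≡-Reasoning

∑-[-t]^· : ∀ b (xs : List A) (F : A → Series) s →
  ∑ xs (λ x → ([-t]^ b · F x) s) ≡ ([-t]^ b · (λ t → ∑ xs (λ x → F x t))) s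
∑-[-t]^· b xs F s =
  trans (∑-*ˡ (𝟙 (b ≤? s)) xs _) (cong (𝟙 (b ≤? s) *ℤ_) (∑-*ˡ (sign b) xs _))

[1+t]^-pascal : ∀ p s → ([1+t]^ suc p) s ≡ ([1+t]^ p) s -ℤ ([-t]^ 1 · [1+t]^ p) s
[1+t]^-pascal p zero    = refl
[1+t]^-pascal p (suc s) = begin
  ℤ.+ (suc p C suc s)                             ≡⟨ cong ℤ.+_ (nCk+nC[k+1]≡[n+1]C[k+1] p s) ⟨
  ℤ.+ (p C s + p C suc s)                         ≡⟨ ℤₚ.pos-+ (p C s) (p C suc s) ⟩
  ℤ.+ (p C s) +ℤ ℤ.+ (p C suc s)                  ≡⟨ rearrange (ℤ.+ (p C s)) (ℤ.+ (p C suc s)) ⟩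
  ℤ.+ (p C suc s) -ℤ 1ℤ *ℤ (-ℤ 1ℤ *ℤ ℤ.+ (p C s))  ∎
  where
  open ≡-Reasoning
  rearrange : ∀ x y → x +ℤ y ≡ y -ℤ 1ℤ *ℤ (-ℤ 1ℤ *ℤ x)
  rearrange = solve-∀

[-t]^·[1+t]^-pascal : ∀ b p s →
  ([-t]^ b · [1+t]^ suc p) s ≡ ([-t]^ b · [1+t]^ p) s -ℤ ([-t]^ 1 · [-t]^ b · [1+t]^ p) s
[-t]^·[1+t]^-pascal b p s = begin
  ([-t]^ b · [1+t]^ suc p) s
    ≡⟨ [-t]^·-cong b ([1+t]^-pascal p) s ⟩
  ([-t]^ b · (λ t → ([1+t]^ p) t +ℤ -ℤ ([-t]^ 1 · [1+t]^ p) t)) s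
    ≡⟨ [-t]^·-+ b ([1+t]^ p) (λ t → -ℤ ([-t]^ 1 · [1+t]^ p) t) s ⟩
  ([-t]^ b · [1+t]^ p) s +ℤ ([-t]^ b · (λ t → -ℤ ([-t]^ 1 · [1+t]^ p) t)) s
    ≡⟨ cong (([-t]^ b · [1+t]^ p) s +ℤ_) ([-t]^·-neg b ([-t]^ 1 · [1+t]^ p) s) ⟩
  ([-t]^ b · [1+t]^ p) s -ℤ ([-t]^ b · [-t]^ 1 · [1+t]^ p) s
    ≡⟨ cong (λ v → ([-t]^ b · [1+t]^ p) s -ℤ v) ([-t]^·-comm b 1 ([1+t]^ p) s) ⟩
  ([-t]^ b · [1+t]^ p) s -ℤ ([-t]^ 1 · [-t]^ b · [1+t]^ p) s ∎
  where open ≡-Reasoning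

∑-[-t]^·-telescope : ∀ x (F : ℕ → Series) → (∀ t → F 0 t ≡ one t) →
  (∀ c t → F (suc c) t ≡ one t -ℤ ([-t]^ 1 · one) t) →
  ∀ s → ∑ (upTo (suc x)) (λ b → ([-t]^ b · F (x ∸ b)) s) ≡ one s
∑-[-t]^·-telescope x F F0 Fsuc s = begin
  ∑ (upTo (suc x)) (λ b → ([-t]^ b · F (x ∸ b)) s)
    ≡⟨ ∑-upTo-∷ʳ x (λ b → ([-t]^ b · F (x ∸ b)) s) ⟩
  ∑ (upTo x) (λ b → ([-t]^ b · F (x ∸ b)) s) +ℤ ([-t]^ x · F (x ∸ x)) s
    ≡⟨ cong₂ _+ℤ_ (∑-congᴬ (applyUpTo⁺₁ _ x middle)) last ⟩
  ∑ (upTo x) (λ b → g b -ℤ g (suc b)) +ℤ g x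
    ≡⟨ ∑-telescope x g ⟩
  g 0
    ≡⟨ [-t]^0· one s ⟩
  one s ∎
  where
  open ≡-Reasoning
  g : ℕ → ℤ
  g b = ([-t]^ b · one) s
  middle : ∀ {b} → b < x → ([-t]^ b · F (x ∸ b)) s ≡ g b -ℤ g (suc b)
  middle {b} b<x = begin
    ([-t]^ b · F (x ∸ b)) s
      ≡⟨ cong (λ c → ([-t]^ b · F c) s) (+-∸-assoc 1 b<x) ⟩
    ([-t]^ b · F (suc (x ∸ suc b))) s
      ≡⟨ [-t]^·-cong b (Fsuc _) s ⟩
    ([-t]^ b · (λ t → one t +ℤ -ℤ ([-t]^ 1 · one) t)) s
      ≡⟨ [-t]^·-+ b one (λ t → -ℤ ([-t]^ 1 · one) t) s ⟩
    g b +ℤ ([-t]^ b · (λ t → -ℤ ([-t]^ 1 · one) t)) s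
      ≡⟨ cong (g b +ℤ_) ([-t]^·-neg b ([-t]^ 1 · one) s) ⟩
    g b -ℤ ([-t]^ b · [-t]^ 1 · one) s
      ≡⟨ cong (λ v → g b -ℤ v) ([-t]^·-[-t]^· b 1 one s) ⟩
    g b -ℤ ([-t]^ (b + 1) · one) s
      ≡⟨ cong (λ e → g b -ℤ ([-t]^ e · one) s) (+-comm b 1) ⟩
    g b -ℤ g (suc b) ∎
  last : ([-t]^ x · F (x ∸ x)) s ≡ g x
  last = trans (cong (λ c → ([-t]^ x · F c) s) (n∸n≡0 x)) ([-t]^·-cong x F0 s)

-- Splittings α = β + γ

∣_∣ : Vec ℕ L → ℕ
∣_∣ = Vec.sum

nonzeros : Vec ℕ L → ℕ
nonzeros []          = 0
nonzeros (zero  ∷ α) = nonzeros α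
nonzeros (suc _ ∷ α) = suc (nonzeros α)

nonzeros≤sum : ∀ (α : Vec ℕ L) → nonzeros α ≤ ∣ α ∣
nonzeros≤sum []          = z≤n
nonzeros≤sum (zero  ∷ α) = nonzeros≤sum α
nonzeros≤sum (suc a ∷ α) = s≤s (≤-trans (nonzeros≤sum α) (m≤n+m ∣ α ∣ a))

suc-pred-nonzeros : ∀ (α : Vec ℕ L) → 0 < ∣ α ∣ → suc (pred (nonzeros α)) ≡ nonzeros α
suc-pred-nonzeros (zero  ∷ α) 0<|α| = suc-pred-nonzeros α 0<|α|
suc-pred-nonzeros (suc a ∷ α) _     = refl

cons₂ : ℕ → ℕ → Vec ℕ L × Vec ℕ L → Vec ℕ (suc L) × Vec ℕ (suc L)
cons₂ b c (β , γ) = b ∷ β , c ∷ γ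

∑-splits-∷ : ∀ x (α : Vec ℕ L) F → ∑ (splits (x ∷ α)) F
  ≡ ∑ (upTo (suc x)) (λ b → ∑ (splits α) (λ (β , γ) → F (b ∷ β , (x ∸ b) ∷ γ)))
∑-splits-∷ x α F = trans (∑-concatMap (λ b → map (cons₂ b (x ∸ b)) (splits α)) (upTo (suc x)) F)
                          (∑-cong (upTo (suc x)) (λ b → ∑-map (cons₂ b (x ∸ b)) (splits α) F))

splits-sum : ∀ (α : Vec ℕ L) → All (λ (β , γ) → ∣ β ∣ + ∣ γ ∣ ≡ ∣ α ∣) (splits α)
splits-sum []      = refl ∷ []
splits-sum (x ∷ α) = concat⁺ (map⁺ (applyUpTo⁺₁ (λ b → b) (suc x) λ {b} b<1+x →
  map⁺ {f = cons₂ b (x ∸ b)} (All.map (λ {p} → prepend b<1+x (proj₁ p) (proj₂ p)) (splits-sum α))))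
  where
  prepend : ∀ {b} → b < suc x → ∀ β γ → ∣ β ∣ + ∣ γ ∣ ≡ ∣ α ∣ →
    b + ∣ β ∣ + ((x ∸ b) + ∣ γ ∣) ≡ x + ∣ α ∣
  prepend {b} b<1+x β γ eq =
    trans (interchange b (∣ β ∣) (x ∸ b) (∣ γ ∣)) (cong₂ _+_ (m+[n∸m]≡n (s≤s⁻¹ b<1+x)) eq)
    where
    interchange : ∀ a b c d → a + b + (c + d) ≡ a + c + (b + d)
    interchange = ℕ-Solver.solve-∀

convolve : (Vec ℕ L → ℕ) → Vec ℕ L → Series
convolve c α s = ∑ (splits α) (λ (β , γ) → ([-t]^ ∣ β ∣ · [1+t]^ c γ) s)

-- The sum factors over the coordinates of α; the factor ∑_{b ≤ x} (-t)^b (1+t)^[b < x] telescopes to 1.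
convolve-nonzeros : ∀ (α : Vec ℕ L) s → convolve nonzeros α s ≡ one s
convolve-nonzeros []      s = trans (ℤₚ.+-identityʳ _) (trans ([-t]^0· ([1+t]^ 0) s) ([1+t]^0 s))
  where
  [1+t]^0 : ∀ s → ([1+t]^ 0) s ≡ one s
  [1+t]^0 zero    = refl
  [1+t]^0 (suc s) = refl
convolve-nonzeros (x ∷ α) s = begin
  convolve nonzeros (x ∷ α) s
    ≡⟨ ∑-splits-∷ x α _ ⟩
  ∑ (upTo (suc x)) (λ b → ∑ (splits α) λ (β , γ) →
                            ([-t]^ (b + ∣ β ∣) · [1+t]^ nonzeros ((x ∸ b) ∷ γ)) s)
    ≡⟨ ∑-cong (upTo (suc x)) factor ⟩
  ∑ (upTo (suc x)) (λ b → ([-t]^ b · first (x ∸ b)) s)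
    ≡⟨ ∑-[-t]^·-telescope x first (convolve-nonzeros α) firstNonzero s ⟩
  one s ∎
  where
  open ≡-Reasoning
  first : ℕ → Series
  first c = convolve (nonzeros ∘ (c ∷_)) α
  factor : ∀ b → ∑ (splits α) (λ (β , γ) → ([-t]^ (b + ∣ β ∣) · [1+t]^ nonzeros ((x ∸ b) ∷ γ)) s)
                 ≡ ([-t]^ b · first (x ∸ b)) s
  factor b =
    trans (∑-cong (splits α) λ (β , γ) → sym ([-t]^·-[-t]^· b ∣ β ∣ ([1+t]^ nonzeros ((x ∸ b) ∷ γ)) s))
          (∑-[-t]^· b (splits α) (λ (β , γ) → [-t]^ ∣ β ∣ · [1+t]^ nonzeros ((x ∸ b) ∷ γ)) s)
  shifted : ∀ t → ∑ (splits α) (λ (β , γ) → ([-t]^ 1 · [-t]^ ∣ β ∣ · [1+t]^ nonzeros γ) t)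
                  ≡ ([-t]^ 1 · convolve nonzeros α) t
  shifted = ∑-[-t]^· 1 (splits α) (λ (β , γ) → [-t]^ ∣ β ∣ · [1+t]^ nonzeros γ)
  firstNonzero : ∀ c t → first (suc c) t ≡ one t -ℤ ([-t]^ 1 · one) t
  firstNonzero c t = begin
    ∑ (splits α) (λ (β , γ) → ([-t]^ ∣ β ∣ · [1+t]^ suc (nonzeros γ)) t)
      ≡⟨ ∑-cong (splits α) (λ (β , γ) → [-t]^·[1+t]^-pascal ∣ β ∣ (nonzeros γ) t) ⟩
    ∑ (splits α) (λ (β , γ) → ([-t]^ ∣ β ∣ · [1+t]^ nonzeros γ) t
                              -ℤ ([-t]^ 1 · [-t]^ ∣ β ∣ · [1+t]^ nonzeros γ) t)
      ≡⟨ ∑-+ (splits α) _ _ ⟩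
    convolve nonzeros α t +ℤ ∑ (splits α) (λ (β , γ) → -ℤ ([-t]^ 1 · [-t]^ ∣ β ∣ · [1+t]^ nonzeros γ) t)
      ≡⟨ cong (convolve nonzeros α t +ℤ_) (trans (∑-neg (splits α) _) (cong -ℤ_ (shifted t))) ⟩
    convolve nonzeros α t -ℤ ([-t]^ 1 · convolve nonzeros α) t
      ≡⟨ cong₂ _-ℤ_ (convolve-nonzeros α t) ([-t]^·-cong 1 (convolve-nonzeros α) t) ⟩
    one t -ℤ ([-t]^ 1 · one) t ∎

-- For p ≥ 1 Pascal's rule gives (1+t)^(p-1) = (1+t)^p + (-t)(1+t)^(p-1). A term contributes to the
-- coefficient of index t only if ∣ β ∣ ≤ t < ∣ α ∣, and then γ ≠ 0, so the rule applies to it.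
convolve-pred-nonzeros-step : ∀ (α : Vec ℕ L) t → t < ∣ α ∣ →
  convolve (pred ∘ nonzeros) α t ≡ convolve nonzeros α t +ℤ ([-t]^ 1 · convolve (pred ∘ nonzeros) α) t
convolve-pred-nonzeros-step α t t<|α| = begin
  convolve (pred ∘ nonzeros) α t
    ≡⟨ ∑-congᴬ (All.map (λ {p} → termwise (proj₁ p) (proj₂ p)) (splits-sum α)) ⟩
  ∑ (splits α) (λ (β , γ) → ([-t]^ ∣ β ∣ · [1+t]^ nonzeros γ) t
                            +ℤ ([-t]^ 1 · [-t]^ ∣ β ∣ · [1+t]^ pred (nonzeros γ)) t)
    ≡⟨ ∑-+ (splits α) _ _ ⟩
  convolve nonzeros α t +ℤ ∑ (splits α) (λ (β , γ) → ([-t]^ 1 · [-t]^ ∣ β ∣ · [1+t]^ pred (nonzeros γ)) t)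
    ≡⟨ cong (convolve nonzeros α t +ℤ_)
            (∑-[-t]^· 1 (splits α) (λ (β , γ) → [-t]^ ∣ β ∣ · [1+t]^ pred (nonzeros γ)) t) ⟩
  convolve nonzeros α t +ℤ ([-t]^ 1 · convolve (pred ∘ nonzeros) α) t ∎
  where
  open ≡-Reasoning
  termwise : ∀ β γ → ∣ β ∣ + ∣ γ ∣ ≡ ∣ α ∣ →
    ([-t]^ ∣ β ∣ · [1+t]^ pred (nonzeros γ)) t
      ≡ ([-t]^ ∣ β ∣ · [1+t]^ nonzeros γ) t +ℤ ([-t]^ 1 · [-t]^ ∣ β ∣ · [1+t]^ pred (nonzeros γ)) t
  termwise β γ |β|+|γ|≡|α| with ∣ β ∣ ≤? t
  ... | yes |β|≤t = begin
    ([-t]^ b · [1+t]^ q) t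
      ≡⟨ move ([-t]^·[1+t]^-pascal b q t) ⟩
    ([-t]^ b · [1+t]^ suc q) t +ℤ ([-t]^ 1 · [-t]^ b · [1+t]^ q) t
      ≡⟨ cong (λ p → ([-t]^ b · [1+t]^ p) t +ℤ ([-t]^ 1 · [-t]^ b · [1+t]^ q) t) 1+q≡p ⟩
    ([-t]^ b · [1+t]^ nonzeros γ) t +ℤ ([-t]^ 1 · [-t]^ b · [1+t]^ q) t ∎
    where
    b = ∣ β ∣
    q = pred (nonzeros γ)
    1+q≡p : suc q ≡ nonzeros γ
    1+q≡p = suc-pred-nonzeros γ (+-cancelˡ-< b 0 ∣ γ ∣
      (subst₂ _<_ (sym (+-identityʳ b)) (sym |β|+|γ|≡|α|) (≤-<-trans |β|≤t t<|α|)))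
    move : ∀ {x y z} → y ≡ x -ℤ z → x ≡ y +ℤ z
    move {x} {y} {z} y≡x-z = trans (cancel x z) (cong (_+ℤ z) (sym y≡x-z))
      where
      cancel : ∀ x z → x ≡ x -ℤ z +ℤ z
      cancel = solve-∀
  ... | no |β|≰t = trans (vanish (pred (nonzeros γ)) t<|β|)
    (sym (cong₂ _+ℤ_ (vanish (nonzeros γ) t<|β|)
                     (trans ([-t]^·-[-t]^· 1 ∣ β ∣ ([1+t]^ pred (nonzeros γ)) t)
                            (vanish (pred (nonzeros γ)) (m<n⇒m<1+n t<|β|)))))
    where
    vanish : ∀ {b} p → t < b → ([-t]^ b · [1+t]^ p) t ≡ 0ℤ
    vanish p = [-t]^·-vanish ([1+t]^ p)
    t<|β| : t < ∣ β ∣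
    t<|β| = ≰⇒> |β|≰t

convolve-pred-nonzeros : ∀ (α : Vec ℕ L) n → n < ∣ α ∣ → convolve (pred ∘ nonzeros) α n ≡ sign n
convolve-pred-nonzeros α zero    0<|α| = begin
  convolve (pred ∘ nonzeros) α 0
    ≡⟨ convolve-pred-nonzeros-step α 0 0<|α| ⟩
  convolve nonzeros α 0 +ℤ ([-t]^ 1 · convolve (pred ∘ nonzeros) α) 0
    ≡⟨ cong₂ _+ℤ_ (convolve-nonzeros α 0) ([-t]^·-vanish {1} (convolve (pred ∘ nonzeros) α) z<s) ⟩
  1ℤ ∎
  where open ≡-Reasoning
convolve-pred-nonzeros α (suc n) n<|α| = begin
  convolve (pred ∘ nonzeros) α (suc n)
    ≡⟨ convolve-pred-nonzeros-step α (suc n) n<|α| ⟩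
  convolve nonzeros α (suc n) +ℤ 1ℤ *ℤ (-ℤ 1ℤ *ℤ convolve (pred ∘ nonzeros) α n)
    ≡⟨ cong₂ (λ u v → u +ℤ 1ℤ *ℤ (-ℤ 1ℤ *ℤ v)) (convolve-nonzeros α (suc n))
             (convolve-pred-nonzeros α n (<-trans (n<1+n n) n<|α|)) ⟩
  0ℤ +ℤ 1ℤ *ℤ (-ℤ 1ℤ *ℤ sign n)
    ≡⟨ simplify (sign n) ⟩
  -ℤ sign n ∎
  where
  open ≡-Reasoning
  simplify : ∀ x → 0ℤ +ℤ 1ℤ *ℤ (-ℤ 1ℤ *ℤ x) ≡ -ℤ x
  simplify = solve-∀

-- Counting tableaux by content

countsMatch : ℕ → Vec ℕ L → (ℕ → ℕ) → Bool
countsMatch lo []      c = true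
countsMatch lo (a ∷ α) c = (c lo ≡ᵇ a) ∧ countsMatch (suc lo) α c

hasContentFrom≡countsMatch : ∀ lo (α : Vec ℕ L) T →
  hasContentFrom lo α T ≡ countsMatch lo α (λ i → countInT i T)
hasContentFrom≡countsMatch lo []      T = refl
hasContentFrom≡countsMatch lo (a ∷ α) T =
  cong ((countInT lo T ≡ᵇ a) ∧_) (hasContentFrom≡countsMatch (suc lo) α T)

countsMatch-cong : ∀ lo (α : Vec ℕ L) {c c′ : ℕ → ℕ} → (∀ i → lo ≤ i → c i ≡ c′ i) →
  countsMatch lo α c ≡ countsMatch lo α c′
countsMatch-cong lo []      c≗c′ = refl
countsMatch-cong lo (a ∷ α) c≗c′ = cong₂ _∧_ (cong (_≡ᵇ a) (c≗c′ lo ≤-refl))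
                                             (countsMatch-cong (suc lo) α (λ i lo<i → c≗c′ i (<⇒≤ lo<i)))

countsMatch-bump : ∀ lo x (β : Vec ℕ L) {c c′ : ℕ → ℕ} →
  c′ lo ≡ suc (c lo) → (∀ i → lo < i → c′ i ≡ c i) →
  countsMatch lo (suc x ∷ β) c′ ≡ countsMatch lo (x ∷ β) c
countsMatch-bump lo x β here there =
  cong₂ _∧_ (cong (_≡ᵇ suc x) here) (countsMatch-cong (suc lo) β there)

countsMatch-bump-zero : ∀ lo (β : Vec ℕ L) {c′ : ℕ → ℕ} {n} →
  c′ lo ≡ suc n → countsMatch lo (0 ∷ β) c′ ≡ false
countsMatch-bump-zero lo β {c′} here = cong (λ m → (m ≡ᵇ 0) ∧ countsMatch (suc lo) β c′) here

countIn-∷-≡ : ∀ lo w → countIn lo (lo ∷ w) ≡ suc (countIn lo w)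
countIn-∷-≡ lo w = cong (λ b → (if b then 1 else 0) + countIn lo w) (dec-true (lo ≟ lo) refl)

countIn-∷-≢ : ∀ {lo i} w → lo < i → countIn i (lo ∷ w) ≡ countIn i w
countIn-∷-≢ {lo} {i} w lo<i =
  cong (λ b → (if b then 1 else 0) + countIn i w) (dec-false (i ≟ lo) (>⇒≢ lo<i))

countIn-absent : ∀ lo w → All (suc lo ≤_) w → countIn lo w ≡ 0
countIn-absent lo []      []           = refl
countIn-absent lo (c ∷ w) (lo<c ∷ w≥) =
  trans (cong (λ b → (if b then 1 else 0) + countIn lo w) (dec-false (lo ≟ c) (<⇒≢ lo<c)))
        (countIn-absent lo w w≥)

countInT-column : ∀ i cs → countInT i (map [_] cs) ≡ countIn i cs
countInT-column i []       = refl
countInT-column i (c ∷ cs) = cong₂ _+_ (+-identityʳ _) (countInT-column i cs)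

matching : List (List ℕ) → List (List ℕ) → ℕ → Vec ℕ L → ℤ
matching rows cols lo α =
  ∑ rows λ ρ → ∑ cols λ cs → ⟦ countsMatch lo α (λ i → countIn i ρ + countIn i cs) ⟧

matching-++ˡ : ∀ rows rows′ cols lo (α : Vec ℕ L) →
  matching (rows ++ rows′) cols lo α ≡ matching rows cols lo α +ℤ matching rows′ cols lo α
matching-++ˡ rows rows′ cols lo α = ∑-++ rows rows′ _

matching-++ʳ : ∀ rows cols cols′ lo (α : Vec ℕ L) →
  matching rows (cols ++ cols′) lo α ≡ matching rows cols lo α +ℤ matching rows cols′ lo α
matching-++ʳ rows cols cols′ lo α = trans (∑-cong rows (λ ρ → ∑-++ cols cols′ _)) (∑-+ rows _ _)

matching-absent : ∀ rows cols lo x (β : Vec ℕ L) →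
  All (All (suc lo ≤_)) rows → All (All (suc lo ≤_)) cols →
  matching rows cols lo (x ∷ β) ≡ 𝟙 (0 ≟ x) *ℤ matching rows cols (suc lo) β
matching-absent rows cols lo x β rows≥ cols≥ = begin
  matching rows cols lo (x ∷ β)
    ≡⟨ ∑-congᴬ (All.map (λ {ρ} ρ≥ → ∑-congᴬ (All.map (λ {cs} → term ρ cs ρ≥) cols≥)) rows≥) ⟩
  ∑ rows (λ ρ → ∑ cols λ cs →
    𝟙 (0 ≟ x) *ℤ ⟦ countsMatch (suc lo) β (λ i → countIn i ρ + countIn i cs) ⟧)
    ≡⟨ trans (∑-cong rows (λ ρ → ∑-*ˡ (𝟙 (0 ≟ x)) cols _)) (∑-*ˡ (𝟙 (0 ≟ x)) rows _) ⟩
  𝟙 (0 ≟ x) *ℤ matching rows cols (suc lo) β ∎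
  where
  open ≡-Reasoning
  term : ∀ ρ cs → All (suc lo ≤_) ρ → All (suc lo ≤_) cs →
    ⟦ countsMatch lo (x ∷ β) (λ i → countIn i ρ + countIn i cs) ⟧
      ≡ 𝟙 (0 ≟ x) *ℤ ⟦ countsMatch (suc lo) β (λ i → countIn i ρ + countIn i cs) ⟧
  term ρ cs ρ≥ cs≥ rewrite countIn-absent lo ρ ρ≥ | countIn-absent lo cs cs≥ = ⟦∧⟧ (0 ≡ᵇ x) _

matching-bumpˡ : ∀ rows cols lo x (β : Vec ℕ L) →
  matching (map (lo ∷_) rows) cols lo (suc x ∷ β) ≡ matching rows cols lo (x ∷ β)
matching-bumpˡ rows cols lo x β =
  trans (∑-map (lo ∷_) rows _) (∑-cong rows λ ρ → ∑-cong cols λ cs → cong ⟦_⟧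
    (countsMatch-bump lo x β (cong (_+ countIn lo cs) (countIn-∷-≡ lo ρ))
                             (λ i lo<i → cong (_+ countIn i cs) (countIn-∷-≢ ρ lo<i))))

matching-bumpˡ-zero : ∀ rows cols lo (β : Vec ℕ L) → matching (map (lo ∷_) rows) cols lo (0 ∷ β) ≡ 0ℤ
matching-bumpˡ-zero rows cols lo β =
  trans (∑-map (lo ∷_) rows _) (trans (∑-cong rows λ ρ → trans (∑-cong cols λ cs → cong ⟦_⟧
    (countsMatch-bump-zero lo β (cong (_+ countIn lo cs) (countIn-∷-≡ lo ρ)))) (∑-zero cols)) (∑-zero rows))

matching-bumpʳ : ∀ rows cols lo x (β : Vec ℕ L) →
  matching rows (map (lo ∷_) cols) lo (suc x ∷ β) ≡ matching rows cols lo (x ∷ β)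
matching-bumpʳ rows cols lo x β =
  ∑-cong rows λ ρ → trans (∑-map (lo ∷_) cols _) (∑-cong cols λ cs → cong ⟦_⟧
    (countsMatch-bump lo x β (trans (cong (countIn lo ρ +_) (countIn-∷-≡ lo cs)) (+-suc _ _))
                             (λ i lo<i → cong (countIn i ρ +_) (countIn-∷-≢ cs lo<i))))

matching-bumpʳ-zero : ∀ rows cols lo (β : Vec ℕ L) → matching rows (map (lo ∷_) cols) lo (0 ∷ β) ≡ 0ℤ
matching-bumpʳ-zero rows cols lo β =
  trans (∑-cong rows λ ρ → trans (∑-map (lo ∷_) cols _) (trans (∑-cong cols λ cs → cong ⟦_⟧
    (countsMatch-bump-zero lo β (trans (cong (countIn lo ρ +_) (countIn-∷-≡ lo cs)) (+-suc _ _))))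
    (∑-zero cols))) (∑-zero rows)

-- The guard x + S = r + t can be split off as x ≤ r: when x > r the equation forces S < t,
-- and the binomial vanishes.
𝟙-peel : ∀ {p S} x r t → p ≤ S →
  𝟙 (x + S ≟ r + t) *ℤ ([1+t]^ p) t ≡ 𝟙 (x ≤? r) *ℤ (𝟙 (S ≟ (r ∸ x) + t) *ℤ ([1+t]^ p) t)
𝟙-peel {p} {S} x r t p≤S = peel (x ≤? r) (x + S ≟ r + t) (S ≟ (r ∸ x) + t)
  where
  peel : (x≤?r : Dec (x ≤ r)) (eq? : Dec (x + S ≡ r + t)) (eq′? : Dec (S ≡ (r ∸ x) + t)) →
    𝟙 eq? *ℤ ([1+t]^ p) t ≡ 𝟙 x≤?r *ℤ (𝟙 eq′? *ℤ ([1+t]^ p) t)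
  peel (yes x≤r) eq? eq′? =
    trans (cong (_*ℤ ([1+t]^ p) t) (𝟙-cong forth back eq? eq′?)) (sym (ℤₚ.*-identityˡ _))
    where
    r+t≡x+[r∸x+t] : r + t ≡ x + ((r ∸ x) + t)
    r+t≡x+[r∸x+t] = trans (cong (_+ t) (sym (m+[n∸m]≡n x≤r))) (+-assoc x (r ∸ x) t)
    forth : x + S ≡ r + t → S ≡ (r ∸ x) + t
    forth eq = +-cancelˡ-≡ x S _ (trans eq r+t≡x+[r∸x+t])
    back : S ≡ (r ∸ x) + t → x + S ≡ r + t
    back eq = trans (cong (x +_) eq) (sym r+t≡x+[r∸x+t])
  peel (no x≰r) (no _)   eq′? = refl
  peel (no x≰r) (yes eq) eq′? =
    trans (ℤₚ.*-identityˡ _) (cong ℤ.+_ (k>n⇒nCk≡0 (≤-<-trans p≤S S<t)))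
    where
    S<t : S < t
    S<t = +-cancelˡ-< r S t (subst (r + S <_) eq (+-monoˡ-< S (≰⇒> x≰r)))

-- The multiplicity x of the smallest letter is shared between the row (x or x ∸ 1 copies)
-- and the strictly increasing column (no copy or one copy).
splitSmallest : (ℕ → ℕ → ℤ) → ℕ → ℕ → ℕ → ℤ
splitSmallest f r j x = 𝟙 (x ≤? r) *ℤ f (r ∸ x) j +ℤ inColumn x j
  where
  inColumn : ℕ → ℕ → ℤ
  inColumn (suc x′) (suc j′) = 𝟙 (x′ ≤? r) *ℤ f (r ∸ x′) j′
  inColumn _        _        = 0ℤ

splitSmallest-cong : ∀ {f g : ℕ → ℕ → ℤ} → (∀ r j → f r j ≡ g r j) →
  ∀ r j x → splitSmallest f r j x ≡ splitSmallest g r j x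
splitSmallest-cong f≗g r j       zero    = cong (λ v → 1ℤ *ℤ v +ℤ 0ℤ) (f≗g r j)
splitSmallest-cong f≗g r zero    (suc x) = cong (λ v → 𝟙 (suc x ≤? r) *ℤ v +ℤ 0ℤ) (f≗g (r ∸ suc x) 0)
splitSmallest-cong f≗g r (suc j) (suc x) =
  cong₂ (λ u v → 𝟙 (suc x ≤? r) *ℤ u +ℤ 𝟙 (x ≤? r) *ℤ v)
        (f≗g (r ∸ suc x) (suc j)) (f≗g (r ∸ x) j)

pairCount : ℕ → ℕ → Vec ℕ L → ℤ
pairCount r j α = 𝟙 (∣ α ∣ ≟ r + j) *ℤ ([1+t]^ nonzeros α) j

pairCount-∷ : ∀ r j x (β : Vec ℕ L) →
  pairCount r j (x ∷ β) ≡ splitSmallest (λ r′ j′ → pairCount r′ j′ β) r j x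
pairCount-∷ r j       zero    β = sym (trans (ℤₚ.+-identityʳ _) (ℤₚ.*-identityˡ _))
pairCount-∷ r zero    (suc x) β = trans (𝟙-peel (suc x) r 0 (nonzeros≤sum β)) (sym (ℤₚ.+-identityʳ _))
pairCount-∷ r (suc j) (suc x) β = begin
  e *ℤ ℤ.+ (suc p C suc j)
    ≡⟨ cong (λ n → e *ℤ ℤ.+ n) (nCk+nC[k+1]≡[n+1]C[k+1] p j) ⟨
  e *ℤ ℤ.+ (p C j + p C suc j)
    ≡⟨ cong (e *ℤ_) (ℤₚ.pos-+ (p C j) (p C suc j)) ⟩
  e *ℤ (ℤ.+ (p C j) +ℤ ℤ.+ (p C suc j))
    ≡⟨ distrib e _ _ ⟩
  e *ℤ ℤ.+ (p C suc j) +ℤ e *ℤ ℤ.+ (p C j)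
    ≡⟨ cong (λ n → e *ℤ ℤ.+ (p C suc j) +ℤ 𝟙 (suc x + S ≟ n) *ℤ ℤ.+ (p C j)) (+-suc r j) ⟩
  e *ℤ ℤ.+ (p C suc j) +ℤ 𝟙 (x + S ≟ r + j) *ℤ ℤ.+ (p C j)
    ≡⟨ cong₂ _+ℤ_ (𝟙-peel (suc x) r (suc j) p≤S) (𝟙-peel x r j p≤S) ⟩
  splitSmallest (λ r′ j′ → pairCount r′ j′ β) r (suc j) (suc x) ∎
  where
  open ≡-Reasoning
  S = ∣ β ∣
  p = nonzeros β
  p≤S = nonzeros≤sum β
  e = 𝟙 (suc x + S ≟ r + suc j)
  distrib : ∀ e a b → e *ℤ (a +ℤ b) ≡ e *ℤ b +ℤ e *ℤ a
  distrib = solve-∀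

hookCount : ℕ → ℕ → Vec ℕ L → ℤ
hookCount m j α = 𝟙 (∣ α ∣ ≟ suc m + j) *ℤ ([1+t]^ pred (nonzeros α)) j

module _ (k : ℕ) where

  letters : ℕ → List ℕ
  letters lo = map (lo +_) (upTo (k ∸ lo))

  letters-suc : ∀ {lo} → lo < k → letters lo ≡ lo ∷ letters (suc lo)
  letters-suc {lo} lo<k = begin
    map (lo +_) (upTo (k ∸ lo))                  ≡⟨ cong (λ n → map (lo +_) (upTo n)) (+-∸-assoc 1 lo<k) ⟩
    lo + 0 ∷ map (lo +_) (applyUpTo suc d)       ≡⟨ cong₂ _∷_ (+-identityʳ lo) shifted ⟩
    lo ∷ map (suc lo +_) (upTo d)                ∎
    where
    open ≡-Reasoning
    d = k ∸ suc lo
    shifted : map (lo +_) (applyUpTo suc d) ≡ map (suc lo +_) (upTo d)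
    shifted = trans (cong (map (lo +_)) (sym (map-upTo suc d)))
                    (trans (sym (map-∘ (upTo d))) (map-cong (+-suc lo) (upTo d)))

  letters-beyond : ∀ {lo} → k ≤ lo → letters lo ≡ []
  letters-beyond {lo} k≤lo = cong (λ n → map (lo +_) (upTo n)) (m≤n⇒m∸n≡0 k≤lo)

  letters-≥ : ∀ lo → All (lo ≤_) (letters lo)
  letters-≥ lo = map⁺ (applyUpTo⁺₂ (λ i → i) (k ∸ lo) (m≤m+n lo))

  ∑-letters-from : ∀ {l} d lo (f : ℕ → ℤ) → d + lo ≡ l →
    ∑ (letters lo) (λ c → 𝟙 (l ≤? c) *ℤ f c) ≡ ∑ (letters l) f
  ∑-letters-from zero    lo f refl = ∑-congᴬ (All.map (λ {c} lo≤c →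
    trans (cong (_*ℤ f c) (𝟙-yes (lo ≤? c) lo≤c)) (ℤₚ.*-identityˡ (f c))) (letters-≥ lo))
  ∑-letters-from {l} (suc d) lo f d+lo≡l with lo <? k
  ... | yes lo<k = begin
    ∑ (letters lo) (λ c → 𝟙 (l ≤? c) *ℤ f c)
      ≡⟨ cong (λ cs → ∑ cs (λ c → 𝟙 (l ≤? c) *ℤ f c)) (letters-suc lo<k) ⟩
    𝟙 (l ≤? lo) *ℤ f lo +ℤ rest
      ≡⟨ cong (λ v → v *ℤ f lo +ℤ rest) (𝟙-no (l ≤? lo) (<⇒≱ lo<l)) ⟩
    0ℤ +ℤ rest
      ≡⟨ ℤₚ.+-identityˡ rest ⟩
    rest
      ≡⟨ ∑-letters-from d (suc lo) f (trans (+-suc d lo) d+lo≡l) ⟩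
    ∑ (letters l) f ∎
    where
    open ≡-Reasoning
    rest = ∑ (letters (suc lo)) (λ c → 𝟙 (l ≤? c) *ℤ f c)
    lo<l : lo < l
    lo<l = subst (lo <_) d+lo≡l (m<n+m lo z<s)
  ... | no lo≮k =
    trans (cong (λ cs → ∑ cs _) (letters-beyond k≤lo)) (cong (λ cs → ∑ cs f) (sym (letters-beyond k≤l)))
    where
    k≤lo = ≮⇒≥ lo≮k
    k≤l  = ≤-trans k≤lo (subst (lo ≤_) d+lo≡l (m≤n+m lo (suc d)))

  -- The possible columns below a hook corner a are incCols (suc a) j.
  incCols : ℕ → ℕ → List (List ℕ)
  incCols lo zero    = [] ∷ []
  incCols lo (suc j) = concatMap (λ a → map (a ∷_) (incCols (suc a) j)) (letters lo)

  incRows-suc : ∀ {lo} r → lo < k →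
    incRows k lo (suc r) ≡ map (lo ∷_) (incRows k lo r) ++ incRows k (suc lo) (suc r)
  incRows-suc r lo<k = cong (concatMap (λ a → map (a ∷_) (incRows k a r))) (letters-suc lo<k)

  incCols-suc : ∀ {lo} j → lo < k →
    incCols lo (suc j) ≡ map (lo ∷_) (incCols (suc lo) j) ++ incCols (suc lo) (suc j)
  incCols-suc j lo<k = cong (concatMap (λ a → map (a ∷_) (incCols (suc a) j))) (letters-suc lo<k)

  incRows-beyond : ∀ r → incRows k k (suc r) ≡ []
  incRows-beyond r = cong (concatMap (λ a → map (a ∷_) (incRows k a r))) (letters-beyond ≤-refl)

  incCols-beyond : ∀ j → incCols k (suc j) ≡ []
  incCols-beyond j = cong (concatMap (λ a → map (a ∷_) (incCols (suc a) j))) (letters-beyond ≤-refl)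

  incRows-≥ : ∀ lo r → All (All (lo ≤_)) (incRows k lo r)
  incRows-≥ lo zero    = [] ∷ []
  incRows-≥ lo (suc r) = concat⁺ (map⁺ (All.map (λ {a} lo≤a →
    map⁺ (All.map (λ a≤w → lo≤a ∷ All.map (≤-trans lo≤a) a≤w) (incRows-≥ a r)))
    (letters-≥ lo)))

  incCols-≥ : ∀ lo j → All (All (lo ≤_)) (incCols lo j)
  incCols-≥ lo zero    = [] ∷ []
  incCols-≥ lo (suc j) = concat⁺ (map⁺ (All.map (λ {a} lo≤a →
    map⁺ (All.map (λ a<w → lo≤a ∷ All.map (≤-trans lo≤a ∘ <⇒≤) a<w) (incCols-≥ (suc a) j)))
    (letters-≥ lo)))

  -- pairs lo lo r j α is the coefficient of x^α in h_r e_j, in the letters lo, …, k ∸ 1.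
  pairs : ℕ → ℕ → ℕ → ℕ → Vec ℕ L → ℤ
  pairs lo lo′ r j = matching (incRows k lo r) (incCols lo′ j) lo

  pairs-columnAbove : ∀ {lo} → lo < k → ∀ r j x (β : Vec ℕ L) →
    pairs lo (suc lo) r j (x ∷ β) ≡ 𝟙 (x ≤? r) *ℤ pairs (suc lo) (suc lo) (r ∸ x) j β
  pairs-columnAbove {lo = lo} lo<k zero j zero    β =
    matching-absent ([] ∷ []) (incCols (suc lo) j) lo 0 β ([] ∷ []) (incCols-≥ (suc lo) j)
  pairs-columnAbove {lo = lo} lo<k zero j (suc x) β =
    matching-absent ([] ∷ []) (incCols (suc lo) j) lo (suc x) β ([] ∷ []) (incCols-≥ (suc lo) j)
  pairs-columnAbove {lo = lo} lo<k (suc r) j x β =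
    trans (cong (λ rows → matching rows cols lo (x ∷ β)) (incRows-suc r lo<k))
          (trans (matching-++ˡ (map (lo ∷_) (incRows k lo r)) (incRows k (suc lo) (suc r)) cols lo (x ∷ β))
                 (split x))
    where
    cols = incCols (suc lo) j
    P : ℕ → ℤ
    P r′ = pairs (suc lo) (suc lo) r′ j β
    absent : ∀ x → matching (incRows k (suc lo) (suc r)) cols lo (x ∷ β) ≡ 𝟙 (0 ≟ x) *ℤ P (suc r)
    absent x = matching-absent _ _ lo x β (incRows-≥ (suc lo) (suc r)) (incCols-≥ (suc lo) j)
    split : ∀ x → matching (map (lo ∷_) (incRows k lo r)) cols lo (x ∷ β)
                  +ℤ matching (incRows k (suc lo) (suc r)) cols lo (x ∷ β)
                  ≡ 𝟙 (x ≤? suc r) *ℤ P (suc r ∸ x)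
    split zero    = trans (cong₂ _+ℤ_ (matching-bumpˡ-zero (incRows k lo r) cols lo β) (absent 0))
                          (ℤₚ.+-identityˡ _)
    split (suc x) = begin
      matching (map (lo ∷_) (incRows k lo r)) cols lo (suc x ∷ β)
        +ℤ matching (incRows k (suc lo) (suc r)) cols lo (suc x ∷ β)
        ≡⟨ cong₂ _+ℤ_ (matching-bumpˡ (incRows k lo r) cols lo x β) (absent (suc x)) ⟩
      pairs lo (suc lo) r j (x ∷ β) +ℤ 0ℤ       ≡⟨ ℤₚ.+-identityʳ _ ⟩
      pairs lo (suc lo) r j (x ∷ β)             ≡⟨ pairs-columnAbove lo<k r j x β ⟩
      𝟙 (x ≤? r) *ℤ P (r ∸ x)                   ≡⟨ cong (_*ℤ P (r ∸ x)) (𝟙-s≤s x r) ⟨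
      𝟙 (suc x ≤? suc r) *ℤ P (r ∸ x)           ∎
      where open ≡-Reasoning

  pairs-∷ : ∀ {lo} → lo < k → ∀ r j x (β : Vec ℕ L) →
    pairs lo lo r j (x ∷ β) ≡ splitSmallest (λ r′ j′ → pairs (suc lo) (suc lo) r′ j′ β) r j x
  pairs-∷ lo<k r zero    zero    β = trans (pairs-columnAbove lo<k r 0 0 β) (sym (ℤₚ.+-identityʳ _))
  pairs-∷ lo<k r zero    (suc x) β = trans (pairs-columnAbove lo<k r 0 (suc x) β) (sym (ℤₚ.+-identityʳ _))
  pairs-∷ {lo = lo} lo<k r (suc j) x β =
    trans (cong (λ cols → matching rows cols lo (x ∷ β)) (incCols-suc j lo<k))
          (trans (matching-++ʳ rows (map (lo ∷_) (incCols (suc lo) j)) (incCols (suc lo) (suc j)) lo (x ∷ β))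
                 (split x))
    where
    rows = incRows k lo r
    P : ℕ → ℕ → ℤ
    P r′ j′ = pairs (suc lo) (suc lo) r′ j′ β
    split : ∀ x → matching rows (map (lo ∷_) (incCols (suc lo) j)) lo (x ∷ β)
                  +ℤ pairs lo (suc lo) r (suc j) (x ∷ β)
                  ≡ splitSmallest P r (suc j) x
    split zero = begin
      matching rows (map (lo ∷_) (incCols (suc lo) j)) lo (0 ∷ β) +ℤ pairs lo (suc lo) r (suc j) (0 ∷ β)
        ≡⟨ cong (_+ℤ pairs lo (suc lo) r (suc j) (0 ∷ β)) (matching-bumpʳ-zero rows (incCols (suc lo) j) lo β) ⟩
      0ℤ +ℤ pairs lo (suc lo) r (suc j) (0 ∷ β)  ≡⟨ ℤₚ.+-identityˡ _ ⟩
      pairs lo (suc lo) r (suc j) (0 ∷ β)        ≡⟨ pairs-columnAbove lo<k r (suc j) 0 β ⟩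
      1ℤ *ℤ P r (suc j)                          ≡⟨ ℤₚ.+-identityʳ _ ⟨
      1ℤ *ℤ P r (suc j) +ℤ 0ℤ                    ∎
      where open ≡-Reasoning
    split (suc x) = begin
      matching rows (map (lo ∷_) (incCols (suc lo) j)) lo (suc x ∷ β) +ℤ pairs lo (suc lo) r (suc j) (suc x ∷ β)
        ≡⟨ cong₂ _+ℤ_ (matching-bumpʳ rows (incCols (suc lo) j) lo x β)
                      (pairs-columnAbove lo<k r (suc j) (suc x) β) ⟩
      pairs lo (suc lo) r j (x ∷ β) +ℤ 𝟙 (suc x ≤? r) *ℤ P (r ∸ suc x) (suc j)
        ≡⟨ cong (_+ℤ 𝟙 (suc x ≤? r) *ℤ P (r ∸ suc x) (suc j)) (pairs-columnAbove lo<k r j x β) ⟩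
      𝟙 (x ≤? r) *ℤ P (r ∸ x) j +ℤ 𝟙 (suc x ≤? r) *ℤ P (r ∸ suc x) (suc j)
        ≡⟨ ℤₚ.+-comm (𝟙 (x ≤? r) *ℤ P (r ∸ x) j) _ ⟩
      splitSmallest P r (suc j) (suc x) ∎
      where open ≡-Reasoning

  pairs-closed : ∀ lo (α : Vec ℕ L) → L + lo ≡ k → ∀ r j → pairs lo lo r j α ≡ pairCount r j α
  pairs-closed lo []      refl zero    zero    = refl
  pairs-closed lo []      refl zero    (suc j) = cong (λ cols → matching ([] ∷ []) cols lo []) (incCols-beyond j)
  pairs-closed lo []      refl (suc r) j       = cong (λ rows → matching rows (incCols lo j) lo []) (incRows-beyond r)
  pairs-closed {suc L} lo (x ∷ β) L+lo≡k r j = begin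
    pairs lo lo r j (x ∷ β)                                          ≡⟨ pairs-∷ lo<k r j x β ⟩
    splitSmallest (λ r′ j′ → pairs (suc lo) (suc lo) r′ j′ β) r j x  ≡⟨ splitSmallest-cong IH r j x ⟩
    splitSmallest (λ r′ j′ → pairCount r′ j′ β) r j x                ≡⟨ pairCount-∷ r j x β ⟨
    pairCount r j (x ∷ β)                                            ∎
    where
    open ≡-Reasoning
    lo<k : lo < k
    lo<k = subst (lo <_) L+lo≡k (s≤s (m≤n+m lo L))
    IH : ∀ r j → pairs (suc lo) (suc lo) r j β ≡ pairCount r j β
    IH = pairs-closed (suc lo) β (trans (+-suc L lo) L+lo≡k)

  hooks : ℕ → ℕ → ℕ → Vec ℕ L → ℤ
  hooks lo m j α = ∑ (letters lo) λ a → matching (map (a ∷_) (incRows k a m)) (incCols (suc a) j) lo α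

  -- The corner of a hook tableau is its smallest letter; removing it leaves a pair counted by pairs.
  hooks-closed : ∀ lo (α : Vec ℕ L) → L + lo ≡ k → ∀ m j → hooks lo m j α ≡ hookCount m j α
  hooks-closed lo []      refl m j =
    cong (λ as → ∑ as (λ a → matching (map (a ∷_) (incRows k a m)) (incCols (suc a) j) lo []))
         (letters-beyond ≤-refl)
  hooks-closed {suc L} lo (x ∷ β) L+lo≡k m j =
    trans (cong (λ as → ∑ as (λ a → withCorner a x)) (letters-suc lo<k)) (split x)
    where
    withCorner : ℕ → ℕ → ℤ
    withCorner a x = matching (map (a ∷_) (incRows k a m)) (incCols (suc a) j) lo (x ∷ β)
    lo<k : lo < k
    lo<k = subst (lo <_) L+lo≡k (s≤s (m≤n+m lo L))
    L+[1+lo]≡k : L + suc lo ≡ k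
    L+[1+lo]≡k = trans (+-suc L lo) L+lo≡k
    cornerAbove : ∀ x → ∑ (letters (suc lo)) (λ a → withCorner a x) ≡ 𝟙 (0 ≟ x) *ℤ hooks (suc lo) m j β
    cornerAbove x = trans (∑-congᴬ (All.map (λ {a} lo<a → matching-absent _ _ lo x β
        (map⁺ (All.map (λ a≤w → lo<a ∷ All.map (≤-trans lo<a) a≤w) (incRows-≥ a m)))
        (All.map (All.map (≤-trans (m≤n⇒m≤1+n lo<a))) (incCols-≥ (suc a) j)))
      (letters-≥ (suc lo)))) (∑-*ˡ (𝟙 (0 ≟ x)) (letters (suc lo)) _)
    split : ∀ x → withCorner lo x +ℤ ∑ (letters (suc lo)) (λ a → withCorner a x) ≡ hookCount m j (x ∷ β)
    split zero = begin
      withCorner lo 0 +ℤ ∑ (letters (suc lo)) (λ a → withCorner a 0)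
        ≡⟨ cong₂ _+ℤ_ (matching-bumpˡ-zero (incRows k lo m) (incCols (suc lo) j) lo β) (cornerAbove 0) ⟩
      0ℤ +ℤ 1ℤ *ℤ hooks (suc lo) m j β
        ≡⟨ trans (ℤₚ.+-identityˡ _) (ℤₚ.*-identityˡ _) ⟩
      hooks (suc lo) m j β
        ≡⟨ hooks-closed (suc lo) β L+[1+lo]≡k m j ⟩
      hookCount m j β ∎
      where open ≡-Reasoning
    split (suc x) = begin
      withCorner lo (suc x) +ℤ ∑ (letters (suc lo)) (λ a → withCorner a (suc x))
        ≡⟨ cong₂ _+ℤ_ (matching-bumpˡ (incRows k lo m) (incCols (suc lo) j) lo x β) (cornerAbove (suc x)) ⟩
      pairs lo (suc lo) m j (x ∷ β) +ℤ 0ℤ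
        ≡⟨ ℤₚ.+-identityʳ _ ⟩
      pairs lo (suc lo) m j (x ∷ β)
        ≡⟨ pairs-columnAbove lo<k m j x β ⟩
      𝟙 (x ≤? m) *ℤ pairs (suc lo) (suc lo) (m ∸ x) j β
        ≡⟨ cong (𝟙 (x ≤? m) *ℤ_) (pairs-closed (suc lo) β L+[1+lo]≡k (m ∸ x) j) ⟩
      𝟙 (x ≤? m) *ℤ pairCount (m ∸ x) j β
        ≡⟨ 𝟙-peel x m j (nonzeros≤sum β) ⟨
      hookCount m j (suc x ∷ β) ∎
      where open ≡-Reasoning

  columnFillings : ∀ j a ρ (p : Tableau → Bool) →
    ∑ (rowFillings k (replicate j 1)) (λ T → ⟦ columnStrict ((a ∷ ρ) ∷ T) ∧ p T ⟧)
      ≡ ∑ (incCols (suc a) j) (λ cs → ⟦ p (map [_] cs) ⟧)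
  columnFillings zero    a ρ p = refl
  columnFillings (suc j) a ρ p = begin
    ∑ (rowFillings k (replicate (suc j) 1)) F
      ≡⟨ ∑-concatMap (λ row → map (row ∷_) below) (incRows k 0 1) F ⟩
    ∑ (incRows k 0 1) (λ row → ∑ (map (row ∷_) below) F)
      ≡⟨ ∑-concatMap (λ c → map (c ∷_) ([] ∷ [])) (letters 0) _ ⟩
    ∑ (letters 0) (λ c → ∑ (map ([ c ] ∷_) below) F +ℤ 0ℤ)
      ≡⟨ ∑-cong (letters 0) (λ c →
           trans (ℤₚ.+-identityʳ _) (trans (∑-map ([ c ] ∷_) below F) (nextEntry c))) ⟩
    ∑ (letters 0) (λ c → 𝟙 (suc a ≤? c) *ℤ ∑ (incCols (suc c) j) (λ cs → ⟦ p ([ c ] ∷ map [_] cs) ⟧))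
      ≡⟨ ∑-letters-from (suc a) 0 _ (+-identityʳ (suc a)) ⟩
    ∑ (letters (suc a)) (λ c → ∑ (incCols (suc c) j) (λ cs → ⟦ p ([ c ] ∷ map [_] cs) ⟧))
      ≡⟨ ∑-cong (letters (suc a)) (λ c → ∑-map (c ∷_) (incCols (suc c) j) _) ⟨
    ∑ (letters (suc a)) (λ c → ∑ (map (c ∷_) (incCols (suc c) j)) (λ cs → ⟦ p (map [_] cs) ⟧))
      ≡⟨ ∑-concatMap (λ c → map (c ∷_) (incCols (suc c) j)) (letters (suc a)) _ ⟨
    ∑ (incCols (suc a) (suc j)) (λ cs → ⟦ p (map [_] cs) ⟧) ∎
    where
    open ≡-Reasoning
    below = rowFillings k (replicate j 1)
    F : Tableau → ℤ
    F T = ⟦ columnStrict ((a ∷ ρ) ∷ T) ∧ p T ⟧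
    strictAt : ∀ c T →
      F ([ c ] ∷ T) ≡ 𝟙 (suc a ≤? c) *ℤ ⟦ columnStrict ([ c ] ∷ T) ∧ p ([ c ] ∷ T) ⟧
    strictAt c T = trans (cong ⟦_⟧ (trans (cong (λ b → (b ∧ columnStrict ([ c ] ∷ T)) ∧ p ([ c ] ∷ T))
                                                (∧-identityʳ (a <ᵇ c)))
                                          (∧-assoc (a <ᵇ c) _ _)))
                         (⟦∧⟧ (a <ᵇ c) _)
    nextEntry : ∀ c → ∑ below (λ T → F ([ c ] ∷ T))
                      ≡ 𝟙 (suc a ≤? c) *ℤ ∑ (incCols (suc c) j) (λ cs → ⟦ p ([ c ] ∷ map [_] cs) ⟧)
    nextEntry c = trans (∑-cong below (strictAt c))
                        (trans (∑-*ˡ (𝟙 (suc a ≤? c)) below _)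
                               (cong (𝟙 (suc a ≤? c) *ℤ_) (columnFillings j c [] (λ T → p ([ c ] ∷ T)))))

  h-coeff : ∀ r (α : Vec ℕ k) → h r k α ≡ 𝟙 (∣ α ∣ ≟ r)
  h-coeff r α = begin
    h r k α
      ≡⟨ countTrue-∑ _ (rowFillings k (r ∷ [])) ⟩
    ∑ (rowFillings k (r ∷ [])) (λ T → ⟦ columnStrict T ∧ hasContentFrom 0 α T ⟧)
      ≡⟨ ∑-concatMap (λ row → map (row ∷_) ([] ∷ [])) (incRows k 0 r) _ ⟩
    ∑ (incRows k 0 r) (λ ρ → ⟦ hasContentFrom 0 α (ρ ∷ []) ⟧ +ℤ 0ℤ)
      ≡⟨ ∑-cong (incRows k 0 r) (λ ρ →
           cong (λ b → ⟦ b ⟧ +ℤ 0ℤ) (hasContentFrom≡countsMatch 0 α (ρ ∷ []))) ⟩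
    pairs 0 0 r 0 α
      ≡⟨ pairs-closed 0 α (+-identityʳ k) r 0 ⟩
    𝟙 (∣ α ∣ ≟ r + 0) *ℤ 1ℤ
      ≡⟨ trans (ℤₚ.*-identityʳ _) (cong (λ n → 𝟙 (∣ α ∣ ≟ n)) (+-identityʳ r)) ⟩
    𝟙 (∣ α ∣ ≟ r) ∎
    where open ≡-Reasoning

  hook-coeff : ∀ m j (α : Vec ℕ k) → schur (hook m j) k α ≡ hookCount m j α
  hook-coeff m j α = begin
    schur (hook m j) k α
      ≡⟨ countTrue-∑ _ (rowFillings k (hook m j)) ⟩
    ∑ (rowFillings k (hook m j)) semistandard
      ≡⟨ ∑-concatMap (λ row → map (row ∷_) below) (incRows k 0 (suc m)) _ ⟩
    ∑ (incRows k 0 (suc m)) (λ w → ∑ (map (w ∷_) below) semistandard)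
      ≡⟨ ∑-concatMap (λ a → map (a ∷_) (incRows k a m)) (letters 0) _ ⟩
    ∑ (letters 0) (λ a → ∑ (map (a ∷_) (incRows k a m)) λ w → ∑ (map (w ∷_) below) semistandard)
      ≡⟨ ∑-cong (letters 0) (λ a → trans (∑-map (a ∷_) (incRows k a m) _)
                                  (trans (∑-cong (incRows k a m) (withCorner a))
                                         (sym (∑-map (a ∷_) (incRows k a m) _)))) ⟩
    hooks 0 m j α
      ≡⟨ hooks-closed 0 α (+-identityʳ k) m j ⟩
    hookCount m j α ∎
    where
    open ≡-Reasoning
    below = rowFillings k (replicate j 1)
    semistandard : Tableau → ℤ
    semistandard T = ⟦ columnStrict T ∧ hasContentFrom 0 α T ⟧
    withCorner : ∀ a ρ → ∑ (map ((a ∷ ρ) ∷_) below) semistandard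
      ≡ ∑ (incCols (suc a) j) (λ cs → ⟦ countsMatch 0 α (λ i → countIn i (a ∷ ρ) + countIn i cs) ⟧)
    withCorner a ρ =
      trans (∑-map ((a ∷ ρ) ∷_) below semistandard)
      (trans (columnFillings j a ρ (λ T → hasContentFrom 0 α ((a ∷ ρ) ∷ T)))
             (∑-cong (incCols (suc a) j) λ cs → cong ⟦_⟧
               (trans (hasContentFrom≡countsMatch 0 α _)
                      (countsMatch-cong 0 α λ i _ → cong (countIn i (a ∷ ρ) +_) (countInT-column i cs)))))

-- The alternating sum

∑-splits-hookCount : ∀ (α : Vec ℕ L) n m →
  ∑ (splits α) (λ (β , γ) → 𝟙 (∣ β ∣ ≤? n) *ℤ (sign ∣ β ∣ *ℤ hookCount m (n ∸ ∣ β ∣) γ))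
    ≡ sign n *ℤ 𝟙 (∣ α ∣ ≟ m + n + 1)
∑-splits-hookCount α n m = begin
  ∑ (splits α) (λ (β , γ) → 𝟙 (∣ β ∣ ≤? n) *ℤ (sign ∣ β ∣ *ℤ hookCount m (n ∸ ∣ β ∣) γ))
    ≡⟨ ∑-congᴬ (All.map (λ {p} → termwise (proj₁ p) (proj₂ p) (∣ proj₁ p ∣ ≤? n)) (splits-sum α)) ⟩
  ∑ (splits α) (λ (β , γ) → sizeOk *ℤ ([-t]^ ∣ β ∣ · [1+t]^ pred (nonzeros γ)) n)
    ≡⟨ ∑-*ˡ sizeOk (splits α) _ ⟩
  sizeOk *ℤ convolve (pred ∘ nonzeros) α n
    ≡⟨ evaluate (∣ α ∣ ≟ m + n + 1) ⟩
  sign n *ℤ sizeOk ∎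
  where
  open ≡-Reasoning
  sizeOk = 𝟙 (∣ α ∣ ≟ m + n + 1)
  termwise : ∀ β γ (b≤?n : Dec (∣ β ∣ ≤ n)) → ∣ β ∣ + ∣ γ ∣ ≡ ∣ α ∣ →
    𝟙 b≤?n *ℤ (sign ∣ β ∣ *ℤ hookCount m (n ∸ ∣ β ∣) γ)
      ≡ sizeOk *ℤ (𝟙 b≤?n *ℤ (sign ∣ β ∣ *ℤ ([1+t]^ pred (nonzeros γ)) (n ∸ ∣ β ∣)))
  termwise β γ (no _)    _  = sym (ℤₚ.*-zeroʳ sizeOk)
  termwise β γ (yes b≤n) eq =
    trans (cong (λ e → 1ℤ *ℤ (sign b *ℤ (e *ℤ coeff)))
                (𝟙-cong forth back (∣ γ ∣ ≟ suc m + (n ∸ b)) (∣ α ∣ ≟ m + n + 1)))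
          (reorder (sign b) sizeOk coeff)
    where
    b = ∣ β ∣
    coeff = ([1+t]^ pred (nonzeros γ)) (n ∸ b)
    b+[1+m+n∸b]≡m+n+1 : b + (suc m + (n ∸ b)) ≡ m + n + 1
    b+[1+m+n∸b]≡m+n+1 = trans (rearrange b m (n ∸ b)) (cong (λ v → m + v + 1) (m+[n∸m]≡n b≤n))
      where
      rearrange : ∀ b m d → b + (suc m + d) ≡ m + (b + d) + 1
      rearrange = ℕ-Solver.solve-∀
    forth : ∣ γ ∣ ≡ suc m + (n ∸ b) → ∣ α ∣ ≡ m + n + 1
    forth eq′ = trans (sym eq) (trans (cong (b +_) eq′) b+[1+m+n∸b]≡m+n+1)
    back : ∣ α ∣ ≡ m + n + 1 → ∣ γ ∣ ≡ suc m + (n ∸ b)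
    back eq′ = +-cancelˡ-≡ b _ _ (trans eq (trans eq′ (sym b+[1+m+n∸b]≡m+n+1)))
    reorder : ∀ σ e y → 1ℤ *ℤ (σ *ℤ (e *ℤ y)) ≡ e *ℤ (1ℤ *ℤ (σ *ℤ y))
    reorder = solve-∀
  evaluate : (d : Dec (∣ α ∣ ≡ m + n + 1)) → 𝟙 d *ℤ convolve (pred ∘ nonzeros) α n ≡ sign n *ℤ 𝟙 d
  evaluate (no _)   = sym (ℤₚ.*-zeroʳ (sign n))
  evaluate (yes eq) = begin
    1ℤ *ℤ convolve (pred ∘ nonzeros) α n  ≡⟨ ℤₚ.*-identityˡ _ ⟩
    convolve (pred ∘ nonzeros) α n        ≡⟨ convolve-pred-nonzeros α n n<|α| ⟩
    sign n                                ≡⟨ ℤₚ.*-identityʳ (sign n) ⟨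
    sign n *ℤ 1ℤ                          ∎
    where
    n<|α| : n < ∣ α ∣
    n<|α| = subst (n <_) (sym eq) (subst (_≤ m + n + 1) (+-comm n 1) (+-monoˡ-≤ 1 (m≤n+m n m)))

lemma2p4 : (n m : ℕ) → 1 ≤ m → (k : ℕ) → (α : Vec ℕ k) →
    sumℤ (map (λ i → sign i *ℤ (h i ⊙ schur (hook m (n ∸ i))) k α) (upTo (n + 1)))
    ≡ sign n *ℤ h (m + n + 1) k α
lemma2p4 n m _ k α = begin
  ∑ (upTo (n + 1)) (λ i → sign i *ℤ (h i ⊙ schur (hook m (n ∸ i))) k α)
    ≡⟨ cong (λ l → ∑ (upTo l) (λ i → sign i *ℤ (h i ⊙ schur (hook m (n ∸ i))) k α)) (+-comm n 1) ⟩
  ∑ (upTo (suc n)) (λ i → sign i *ℤ ∑ (splits α) (λ (β , γ) → h i k β *ℤ schur (hook m (n ∸ i)) k γ))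
    ≡⟨ ∑-cong (upTo (suc n)) (λ i → cong (sign i *ℤ_) (∑-cong (splits α) λ (β , γ) →
         cong₂ _*ℤ_ (h-coeff k i β) (hook-coeff k m (n ∸ i) γ))) ⟩
  ∑ (upTo (suc n)) (λ i → sign i *ℤ ∑ (splits α) λ (β , γ) → 𝟙 (∣ β ∣ ≟ i) *ℤ hookCount m (n ∸ i) γ)
    ≡⟨ ∑-sign-δ n (splits α) (∣_∣ ∘ proj₁) (λ i (β , γ) → hookCount m (n ∸ i) γ) ⟩
  ∑ (splits α) (λ (β , γ) → 𝟙 (∣ β ∣ ≤? n) *ℤ (sign ∣ β ∣ *ℤ hookCount m (n ∸ ∣ β ∣) γ))
    ≡⟨ ∑-splits-hookCount α n m ⟩
  sign n *ℤ 𝟙 (∣ α ∣ ≟ m + n + 1)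
    ≡⟨ cong (sign n *ℤ_) (h-coeff k (m + n + 1) α) ⟨
  sign n *ℤ h (m + n + 1) k α ∎
  where open ≡-Reasoning
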